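{- Let $n = sk+t$ with integers $s \ge 4$, $k \ge 4$ and $0 \le t \le k-1$. Define $l' = \lfloor (n-1)/(k-1) \rfloor$, $l = \lfloor (l'+1)/2 \rfloor$ if $(n,k) = (19,4)$ and $l = \lceil (l'+1)/2 \rceil$ if $(n,k) \ne (19,4)$, and $n' = n - l(k-1)$. Then (a) $l \le \frac{l'+2}{2} \le \frac{1}{2}\left(s+3+\frac{s-1}{k-1}\right)$; (b) $\frac{n}{2} < l(k-1)+1 \le \frac{n-1}{2} + k$; (c) $\frac{1}{l}\binom{n-n'}{k-1} > n'$. -}

module Defs where

open import Data.Nat as ℕ using (ℕ; zero; suc; _∸_; _≡ᵇ_; ⌊_/2⌋; ⌈_/2⌉)
open import Data.Nat.DivMod as DM using ()
open import Data.Bool using (Bool; if_then_else_; _∧_)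
open import Data.Integer using (+_)
open import Data.Rational as ℚ using (ℚ; _/_; _*_)

⟦_⟧ : ℕ → ℚ
⟦ n ⟧ = (+ n) / 1

-- floor division on ℕ, made total (division by 0 gives 0; never used
-- in the statement, where the divisor is k-1 ≥ 3)
_div_ : ℕ → ℕ → ℕ
m div zero    = 0
m div (suc d) = m DM./ suc d

-- division of a rational by a natural number, made total
-- (division by 0 gives 0; never used in the statement: divisors are 2, k-1 ≥ 3, l ≥ 1)
_÷ℕ_ : ℚ → ℕ → ℚ
p ÷ℕ zero    = ℚ.0ℚ
p ÷ℕ (suc d) = p * ((+ 1) / suc d)

l′ : ℕ → ℕ → ℕ
l′ n k = (n ∸ 1) div (k ∸ 1)

ell : ℕ → ℕ → ℕ
ell n k = if (n ≡ᵇ 19) ∧ (k ≡ᵇ 4) then ⌊ l′ n k ℕ.+ 1 /2⌋ else ⌈ l′ n k ℕ.+ 1 /2⌉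

n′ : ℕ → ℕ → ℚ
n′ n k = ⟦ n ⟧ ℚ.- ⟦ ell n k ℕ.* (k ∸ 1) ⟧

-- Write m = k - 1.  Clearing denominators turns every bound into an inequality of naturals.
-- Division gives l′m ≤ n - 1 < (l′ + 1)m and the ceiling gives l′ + 1 ≤ 2l ≤ l′ + 2, so
-- n ≤ 2lm ≤ n - 1 + 2m; this yields (a) and (b), and (c) becomes n′l < C(lm, m) with
-- n′ = n - lm ≤ lm.  Now l·lm < lm(lm - 1)/2 = C(lm, 2) ≤ C(lm, m) because l ≥ 2, m ≥ 3 and
-- the binomial coefficients increase up to the middle (2m ≤ lm + 1).  The exceptional
-- pair (n, k) = (19, 4) is checked by evaluation.

module Submission where

open import Defs
open import Data.Nat using (ℕ; zero; suc; _∸_; _≤_; _<_; _+_; _*_; z≤n; s≤s; _≡ᵇ_; ⌊_/2⌋; ⌈_/2⌉)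
open import Data.Nat.Properties
open import Data.Nat.DivMod using (_/_; _%_; m≡m%n+[m/n]*n; m%n<n; m/n*n≤m)
open import Data.Nat.Combinatorics using (_C_; nC1≡n; nCk+nC[k+1]≡[n+1]C[k+1])
open import Data.Nat.Tactic.RingSolver using (solve)
import Data.Integer as ℤ
import Data.Integer.Properties as ℤP
open import Data.Rational as ℚ using (ℚ)
import Data.Rational.Properties as ℚP
import Data.Rational.Unnormalised as ℚᵘ
open ℚᵘ using (mkℚᵘ; *≤*; *<*)
import Data.Rational.Unnormalised.Properties as ℚᵘP
open import Data.List using (_∷_; [])
open import Data.Product using (_×_; _,_)
open import Data.Sum using (_⊎_; inj₁; inj₂)
open import Data.Bool using (true; false; T; if_then_else_; _∧_)
open import Data.Bool.Properties using (T-∧)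
open import Function using (Equivalence)
open import Relation.Nullary using (contradiction)
open import Relation.Binary.PropositionalEquality

≤-by : ∀ {a b c d} → c ≤ d → a ≡ c → b ≡ d → a ≤ b
≤-by c≤d refl refl = c≤d

<-by : ∀ {a b c d} → c < d → a ≡ c → b ≡ d → suc a ≤ b
<-by c<d a≡c = ≤-by c<d (cong suc a≡c)

-- p ≐ a /1+ e certifies that p is the fraction a/(1 + e) (the denominator convention of ℚᵘ),
-- so that comparisons of such rationals reduce to cross-multiplied comparisons in ℕ.
infix 4 _≐_/1+_

_≐_/1+_ : ℚ → ℕ → ℕ → Set
p ≐ a /1+ e = ℚ.toℚᵘ p ℚᵘ.≃ mkℚᵘ (ℤ.+ a) e

⟦⟧-≐ : ∀ a → ⟦ a ⟧ ≐ a /1+ 0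
⟦⟧-≐ a = ℚP.toℚᵘ-fromℚᵘ (mkℚᵘ (ℤ.+ a) 0)

*-≐ : ∀ {p q a b e f} → p ≐ a /1+ e → q ≐ b /1+ f → p ℚ.* q ≐ a * b /1+ (f + e * suc f)
*-≐ {p} {q} {a} {b} {e} {f} p≐ q≐ = begin
  ℚ.toℚᵘ (p ℚ.* q)                        ≈⟨ ℚP.toℚᵘ-homo-* p q ⟩
  ℚ.toℚᵘ p ℚᵘ.* ℚ.toℚᵘ q                  ≈⟨ ℚᵘP.*-cong p≐ q≐ ⟩
  mkℚᵘ (ℤ.+ a ℤ.* ℤ.+ b) (f + e * suc f)  ≡⟨ cong (λ i → mkℚᵘ i _) (ℤP.pos-* a b) ⟨
  mkℚᵘ (ℤ.+ (a * b)) (f + e * suc f)      ∎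
  where open ℚᵘP.≃-Reasoning

÷ℕ-≐ : ∀ {p a e} d → p ≐ a /1+ e → p ÷ℕ suc d ≐ a * 1 /1+ (d + e * suc d)
÷ℕ-≐ d p≐ = *-≐ p≐ (ℚP.toℚᵘ-fromℚᵘ (mkℚᵘ (ℤ.+ 1) d))

+-≐ : ∀ {p q a b e f} → p ≐ a /1+ e → q ≐ b /1+ f →
      p ℚ.+ q ≐ a * suc f + b * suc e /1+ (f + e * suc f)
+-≐ {p} {q} {a} {b} {e} {f} p≐ q≐ = begin
  ℚ.toℚᵘ (p ℚ.+ q)                                                     ≈⟨ ℚP.toℚᵘ-homo-+ p q ⟩
  ℚ.toℚᵘ p ℚᵘ.+ ℚ.toℚᵘ q                                               ≈⟨ ℚᵘP.+-cong p≐ q≐ ⟩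
  mkℚᵘ (ℤ.+ a ℤ.* ℤ.+ suc f ℤ.+ ℤ.+ b ℤ.* ℤ.+ suc e) (f + e * suc f)  ≡⟨ cong (λ i → mkℚᵘ i _) pos-cross ⟨
  mkℚᵘ (ℤ.+ (a * suc f + b * suc e)) (f + e * suc f)                   ∎
  where
  open ℚᵘP.≃-Reasoning
  pos-cross : ℤ.+ (a * suc f + b * suc e) ≡ ℤ.+ a ℤ.* ℤ.+ suc f ℤ.+ ℤ.+ b ℤ.* ℤ.+ suc e
  pos-cross = trans (ℤP.pos-+ (a * suc f) (b * suc e))
                    (cong₂ ℤ._+_ (ℤP.pos-* a (suc f)) (ℤP.pos-* b (suc e)))

-‿≐ : ∀ {a b} → b ≤ a → ⟦ a ⟧ ℚ.- ⟦ b ⟧ ≐ a ∸ b /1+ 0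
-‿≐ {a} {b} b≤a = begin
  ℚ.toℚᵘ (⟦ a ⟧ ℚ.- ⟦ b ⟧)
    ≈⟨ ℚP.toℚᵘ-homo-+ ⟦ a ⟧ (ℚ.- ⟦ b ⟧) ⟩
  ℚ.toℚᵘ ⟦ a ⟧ ℚᵘ.+ ℚ.toℚᵘ (ℚ.- ⟦ b ⟧)
    ≈⟨ ℚᵘP.+-cong (⟦⟧-≐ a) (ℚᵘP.≃-trans (ℚP.toℚᵘ-homo‿- ⟦ b ⟧) (ℚᵘP.-‿cong (⟦⟧-≐ b))) ⟩
  mkℚᵘ (ℤ.+ a ℤ.* ℤ.+ 1 ℤ.+ ℤ.- ℤ.+ b ℤ.* ℤ.+ 1) 0
    ≡⟨ cong (λ i → mkℚᵘ i 0) pos-∸ ⟨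
  mkℚᵘ (ℤ.+ (a ∸ b)) 0
    ∎
  where
  open ℚᵘP.≃-Reasoning
  pos-∸ : ℤ.+ (a ∸ b) ≡ ℤ.+ a ℤ.* ℤ.+ 1 ℤ.+ ℤ.- ℤ.+ b ℤ.* ℤ.+ 1
  pos-∸ = sym (trans (cong₂ ℤ._+_ (ℤP.*-identityʳ (ℤ.+ a)) (ℤP.*-identityʳ (ℤ.- ℤ.+ b)))
                     (trans (ℤP.m-n≡m⊖n a b) (ℤP.⊖-≥ b≤a)))

≤-≐ : ∀ {p q a b e f} → p ≐ a /1+ e → q ≐ b /1+ f → a * suc f ≤ b * suc e → p ℚ.≤ q
≤-≐ {a = a} {b} {e} {f} p≐ q≐ le =
  ℚP.toℚᵘ-cancel-≤ (ℚᵘP.≤-respˡ-≃ (ℚᵘP.≃-sym p≐) (ℚᵘP.≤-respʳ-≃ (ℚᵘP.≃-sym q≐)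
    (*≤* (subst₂ ℤ._≤_ (ℤP.pos-* a (suc f)) (ℤP.pos-* b (suc e)) (ℤ.+≤+ le)))))

<-≐ : ∀ {p q a b e f} → p ≐ a /1+ e → q ≐ b /1+ f → a * suc f < b * suc e → p ℚ.< q
<-≐ {a = a} {b} {e} {f} p≐ q≐ lt =
  ℚP.toℚᵘ-cancel-< (ℚᵘP.<-respˡ-≃ (ℚᵘP.≃-sym p≐) (ℚᵘP.<-respʳ-≃ (ℚᵘP.≃-sym q≐)
    (*<* (subst₂ ℤ._<_ (ℤP.pos-* a (suc f)) (ℤP.pos-* b (suc e)) (ℤ.+<+ lt)))))

⟦⟧≤⟦⟧÷2 : ∀ a b → 2 * a ≤ b → ⟦ a ⟧ ℚ.≤ ⟦ b ⟧ ÷ℕ 2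
⟦⟧≤⟦⟧÷2 a b le = ≤-≐ (⟦⟧-≐ a) (÷ℕ-≐ 1 (⟦⟧-≐ b)) (≤-by le (solve (a ∷ [])) (solve (b ∷ [])))

⟦⟧÷2<⟦⟧ : ∀ a b → a < 2 * b → ⟦ a ⟧ ÷ℕ 2 ℚ.< ⟦ b ⟧
⟦⟧÷2<⟦⟧ a b lt = <-≐ (÷ℕ-≐ 1 (⟦⟧-≐ a)) (⟦⟧-≐ b) (<-by lt (solve (a ∷ [])) (solve (b ∷ [])))

⟦⟧≤⟦⟧÷2+⟦⟧ : ∀ a b c → 2 * a ≤ b + 2 * c → ⟦ a ⟧ ℚ.≤ ⟦ b ⟧ ÷ℕ 2 ℚ.+ ⟦ c ⟧
⟦⟧≤⟦⟧÷2+⟦⟧ a b c le = ≤-≐ (⟦⟧-≐ a) (+-≐ (÷ℕ-≐ 1 (⟦⟧-≐ b)) (⟦⟧-≐ c))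
  (≤-by le (solve (a ∷ [])) (solve (b ∷ c ∷ [])))

⟦⟧÷2≤[⟦⟧+⟦⟧÷d]÷2 : ∀ a b c d → a * suc d ≤ b * suc d + c →
                   ⟦ a ⟧ ÷ℕ 2 ℚ.≤ (⟦ b ⟧ ℚ.+ ⟦ c ⟧ ÷ℕ suc d) ÷ℕ 2
⟦⟧÷2≤[⟦⟧+⟦⟧÷d]÷2 a b c d le = ≤-≐ (÷ℕ-≐ 1 (⟦⟧-≐ a)) (÷ℕ-≐ 1 (+-≐ (⟦⟧-≐ b) (÷ℕ-≐ d (⟦⟧-≐ c))))
  (≤-by twice-le (solve (a ∷ d ∷ [])) (solve (b ∷ c ∷ d ∷ [])))
  where
  twice-le : a * suc d * 2 ≤ (b * suc d + c) * 2
  twice-le = *-monoˡ-≤ 2 le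

⟦⟧-⟦⟧<⟦⟧÷l*⟦⟧ : ∀ a b c l → b ≤ a → (a ∸ b) * suc l < c →
                ⟦ a ⟧ ℚ.- ⟦ b ⟧ ℚ.< (⟦ 1 ⟧ ÷ℕ suc l) ℚ.* ⟦ c ⟧
⟦⟧-⟦⟧<⟦⟧÷l*⟦⟧ a b c l b≤a lt = <-≐ (-‿≐ b≤a) (*-≐ (÷ℕ-≐ l (⟦⟧-≐ 1)) (⟦⟧-≐ c)) (cross {a ∸ b} lt)
  where
  -- a ∸ b is generalised to x so that the ring solver sees a variable
  cross : ∀ {x} → x * suc l < c → x * suc (0 + (l + 0 * suc l) * 1) < 1 * 1 * c * 1
  cross {x} x[1+l]<c = <-by x[1+l]<c (solve (x ∷ l ∷ [])) (solve (c ∷ []))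

[1+k]*[1+n]C[1+k]≡[1+n]*nCk : ∀ n k → suc k * (suc n C suc k) ≡ suc n * (n C k)
[1+k]*[1+n]C[1+k]≡[1+n]*nCk zero    zero    = refl
[1+k]*[1+n]C[1+k]≡[1+n]*nCk zero    (suc k) = *-zeroʳ (suc (suc k))
[1+k]*[1+n]C[1+k]≡[1+n]*nCk (suc n) zero    =
  trans (*-identityˡ _) (trans (nC1≡n (suc (suc n))) (sym (*-identityʳ _)))
[1+k]*[1+n]C[1+k]≡[1+n]*nCk (suc n) (suc k) = begin
  suc (suc k) * (suc (suc n) C suc (suc k))
    ≡⟨ cong (suc (suc k) *_) (nCk+nC[k+1]≡[n+1]C[k+1] (suc n) (suc k)) ⟨
  suc (suc k) * (suc n C suc k + suc n C suc (suc k))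
    ≡⟨ *-distribˡ-+ (suc (suc k)) (suc n C suc k) _ ⟩
  suc n C suc k + suc k * (suc n C suc k) + suc (suc k) * (suc n C suc (suc k))
    ≡⟨ cong₂ (λ x y → suc n C suc k + x + y) ([1+k]*[1+n]C[1+k]≡[1+n]*nCk n k)
                                             ([1+k]*[1+n]C[1+k]≡[1+n]*nCk n (suc k)) ⟩
  suc n C suc k + suc n * (n C k) + suc n * (n C suc k)
    ≡⟨ +-assoc (suc n C suc k) _ _ ⟩
  suc n C suc k + (suc n * (n C k) + suc n * (n C suc k))
    ≡⟨ cong ((suc n C suc k) +_) (*-distribˡ-+ (suc n) (n C k) _) ⟨
  suc n C suc k + suc n * (n C k + n C suc k)
    ≡⟨ cong (λ x → suc n C suc k + suc n * x) (nCk+nC[k+1]≡[n+1]C[k+1] n k) ⟩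
  suc (suc n) * (suc n C suc k) ∎
  where open ≡-Reasoning

nCk≤nC[1+k] : ∀ {n k} → suc k + suc k ≤ suc n → n C k ≤ n C suc k
nCk≤nC[1+k] {n} {k} 2[1+k]≤1+n = *-cancelˡ-≤ (suc k) (+-cancelˡ-≤ (suc k * x) _ _ (begin
  suc k * x + suc k * x   ≡⟨ *-distribʳ-+ x (suc k) (suc k) ⟨
  (suc k + suc k) * x     ≤⟨ *-monoˡ-≤ x 2[1+k]≤1+n ⟩
  suc n * x               ≡⟨ [1+k]*[1+n]C[1+k]≡[1+n]*nCk n k ⟨
  suc k * (suc n C suc k) ≡⟨ cong (suc k *_) (nCk+nC[k+1]≡[n+1]C[k+1] n k) ⟨
  suc k * (x + y)         ≡⟨ *-distribˡ-+ (suc k) x y ⟩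
  suc k * x + suc k * y   ∎))
  where
  open ≤-Reasoning
  x = n C k
  y = n C suc k

nCj≤nCk : ∀ {n j k} → j ≤ k → k + k ≤ suc n → n C j ≤ n C k
nCj≤nCk {n} {k = zero}  j≤0   _ = ≤-reflexive (cong (n C_) (n≤0⇒n≡0 j≤0))
nCj≤nCk {n} {k = suc k} j≤1+k 2[1+k]≤1+n with m≤n⇒m<n∨m≡n j≤1+k
... | inj₂ refl      = ≤-refl
... | inj₁ (s≤s j≤k) = ≤-trans (nCj≤nCk j≤k (≤-trans (+-mono-≤ (n≤1+n k) (n≤1+n k)) 2[1+k]≤1+n))
                               (nCk≤nC[1+k] 2[1+k]≤1+n)

n*l<nC2 : ∀ {n l} → suc (2 * l) < n → n * l < n C 2
n*l<nC2 {suc n} {l} (s≤s 2l<n) = *-cancelˡ-< 2 (suc n * l) _ (begin-strict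
  2 * (suc n * l)   ≡⟨ *-comm 2 (suc n * l) ⟩
  suc n * l * 2     ≡⟨ *-assoc (suc n) l 2 ⟩
  suc n * (l * 2)   ≡⟨ cong (suc n *_) (*-comm l 2) ⟩
  suc n * (2 * l)   <⟨ *-monoʳ-< (suc n) 2l<n ⟩
  suc n * n         ≡⟨ cong (suc n *_) (nC1≡n n) ⟨
  suc n * (n C 1)   ≡⟨ [1+k]*[1+n]C[1+k]≡[1+n]*nCk n 1 ⟨
  2 * (suc n C 2)   ∎)
  where open ≤-Reasoning

l*m*l<[l*m]Cm : ∀ {l m} → 2 ≤ l → 3 ≤ m → l * m * l < (l * m) C m
l*m*l<[l*m]Cm {l} {m} 2≤l 3≤m =
  <-≤-trans (n*l<nC2 2l+1<lm) (nCj≤nCk (≤-trans (s≤s (s≤s z≤n)) 3≤m) m+m≤1+lm)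
  where
  open ≤-Reasoning
  2l+1<lm : suc (2 * l) < l * m
  2l+1<lm = begin
    2 + 2 * l ≤⟨ +-monoˡ-≤ (2 * l) 2≤l ⟩
    3 * l     ≤⟨ *-monoˡ-≤ l 3≤m ⟩
    m * l     ≡⟨ *-comm m l ⟩
    l * m     ∎
  m+m≤1+lm : m + m ≤ suc (l * m)
  m+m≤1+lm = begin
    m + m     ≡⟨ cong (m +_) (+-identityʳ m) ⟨
    2 * m     ≤⟨ *-monoˡ-≤ m 2≤l ⟩
    l * m     ≤⟨ n≤1+n (l * m) ⟩
    suc (l * m) ∎

m<[1+m/n]*n : ∀ m n → m < suc (m / suc n) * suc n
m<[1+m/n]*n m n = begin-strict
  m                             ≡⟨ m≡m%n+[m/n]*n m (suc n) ⟩
  m % suc n + m / suc n * suc n <⟨ +-monoˡ-< _ (m%n<n m (suc n)) ⟩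
  suc (m / suc n) * suc n       ∎
  where open ≤-Reasoning

n≤2*⌈n/2⌉ : ∀ n → n ≤ 2 * ⌈ n /2⌉
n≤2*⌈n/2⌉ n = begin
  n                     ≡⟨ ⌊n/2⌋+⌈n/2⌉≡n n ⟨
  ⌊ n /2⌋ + ⌈ n /2⌉     ≤⟨ +-monoˡ-≤ ⌈ n /2⌉ (⌊n/2⌋≤⌈n/2⌉ n) ⟩
  ⌈ n /2⌉ + ⌈ n /2⌉     ≡⟨ cong (⌈ n /2⌉ +_) (+-identityʳ ⌈ n /2⌉) ⟨
  2 * ⌈ n /2⌉           ∎
  where open ≤-Reasoning

2*⌈n/2⌉≤n+1 : ∀ n → 2 * ⌈ n /2⌉ ≤ n + 1
2*⌈n/2⌉≤n+1 n = begin
  2 * ⌈ n /2⌉               ≡⟨ cong (⌈ n /2⌉ +_) (+-identityʳ ⌈ n /2⌉) ⟩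
  ⌈ n /2⌉ + ⌈ n /2⌉         ≤⟨ +-monoʳ-≤ ⌈ n /2⌉ (⌊n/2⌋≤⌈n/2⌉ (suc n)) ⟩
  ⌈ n /2⌉ + ⌈ suc n /2⌉     ≡⟨ ⌊n/2⌋+⌈n/2⌉≡n (suc n) ⟩
  suc n                     ≡⟨ +-comm 1 n ⟩
  n + 1                     ∎
  where open ≤-Reasoning

record IntegerBounds (n m l l′ : ℕ) : Set where
  field
    0<l            : 0 < l
    2l≤l′+2        : 2 * l ≤ l′ + 2
    n<2[lm+1]      : n < 2 * (l * m + 1)
    2[lm+1]≤n∸1+2k : 2 * (l * m + 1) ≤ n ∸ 1 + 2 * suc m
    lm≤n           : l * m ≤ n
    [n∸lm]l<[lm]Cm : (n ∸ l * m) * l < (l * m) C m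

integerBounds : ∀ {n m l l′} → 3 ≤ m → 4 * suc m ≤ n →
                l′ * m ≤ n ∸ 1 → n ∸ 1 < suc l′ * m →
                l′ + 1 ≤ 2 * l → 2 * l ≤ l′ + 1 + 1 → IntegerBounds n m l l′
integerBounds {n} {m} {l} {l′} 3≤m 4[1+m]≤n l′m≤n∸1 n∸1<[1+l′]m l′+1≤2l 2l≤l′+1+1 = record
  { 0<l            = <-trans (s≤s z≤n) 2<l
  ; 2l≤l′+2        = 2l≤l′+2
  ; n<2[lm+1]      = ≤-<-trans n≤2lm (*-monoʳ-< 2 (m<m+n (l * m) (s≤s z≤n)))
  ; 2[lm+1]≤n∸1+2k = begin
      2 * (l * m + 1)         ≡⟨ solve (l ∷ m ∷ []) ⟩
      2 * (l * m) + 2         ≤⟨ +-monoˡ-≤ 2 2lm≤n∸1+2m ⟩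
      n ∸ 1 + 2 * m + 2       ≡⟨ +-assoc (n ∸ 1) (2 * m) 2 ⟩
      n ∸ 1 + (2 * m + 2)     ≡⟨ cong ((n ∸ 1) +_) (solve (m ∷ [])) ⟩
      n ∸ 1 + 2 * suc m       ∎
  ; lm≤n           = *-cancelˡ-≤ 2 (begin
      2 * (l * m)             ≤⟨ 2lm≤n∸1+2m ⟩
      n ∸ 1 + 2 * m           ≤⟨ +-mono-≤ (m∸n≤m n 1) 2m≤n ⟩
      n + n                   ≡⟨ cong (n +_) (+-identityʳ n) ⟨
      2 * n                   ∎)
  ; [n∸lm]l<[lm]Cm = ≤-<-trans (*-monoˡ-≤ l n∸lm≤lm) (l*m*l<[l*m]Cm (<⇒≤ 2<l) 3≤m)
  }
  where
  open ≤-Reasoning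
  2l≤l′+2 : 2 * l ≤ l′ + 2
  2l≤l′+2 = ≤-trans 2l≤l′+1+1 (≤-reflexive (+-assoc l′ 1 1))
  n≤2lm : n ≤ 2 * (l * m)
  n≤2lm = begin
    n              ≤⟨ m≤n+m∸n n 1 ⟩
    suc (n ∸ 1)    ≤⟨ n∸1<[1+l′]m ⟩
    suc l′ * m     ≡⟨ cong (_* m) (+-comm 1 l′) ⟩
    (l′ + 1) * m   ≤⟨ *-monoˡ-≤ m l′+1≤2l ⟩
    2 * l * m      ≡⟨ *-assoc 2 l m ⟩
    2 * (l * m)    ∎
  2lm≤n∸1+2m : 2 * (l * m) ≤ n ∸ 1 + 2 * m
  2lm≤n∸1+2m = begin
    2 * (l * m)    ≡⟨ *-assoc 2 l m ⟨
    2 * l * m      ≤⟨ *-monoˡ-≤ m 2l≤l′+2 ⟩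
    (l′ + 2) * m   ≡⟨ *-distribʳ-+ m l′ 2 ⟩
    l′ * m + 2 * m ≤⟨ +-monoˡ-≤ (2 * m) l′m≤n∸1 ⟩
    n ∸ 1 + 2 * m  ∎
  2m≤n : 2 * m ≤ n
  2m≤n = ≤-trans (*-mono-≤ {2} {4} (s≤s (s≤s z≤n)) (n≤1+n m)) 4[1+m]≤n
  2<l : 2 < l
  2<l = *-cancelˡ-< 2 2 l (*-cancelʳ-< m (2 * 2) (2 * l) (begin-strict
    4 * m          <⟨ *-monoʳ-< 4 (n<1+n m) ⟩
    4 * suc m      ≤⟨ 4[1+m]≤n ⟩
    n              ≤⟨ n≤2lm ⟩
    2 * (l * m)    ≡⟨ *-assoc 2 l m ⟨
    2 * l * m      ∎))
  n∸lm≤lm : n ∸ l * m ≤ l * m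
  n∸lm≤lm = m≤n+o⇒m∸n≤o n (l * m)
    (≤-trans n≤2lm (≤-reflexive (cong (l * m +_) (+-identityʳ (l * m)))))

[l′+2]m≤[1+s+3]m+s : ∀ {s m t l′} → t ≤ m → l′ * m ≤ suc s * suc m + t ∸ 1 →
                       (l′ + 2) * m ≤ (suc s + 3) * m + s
[l′+2]m≤[1+s+3]m+s {s} {m} {t} {l′} t≤m l′m≤n∸1 = begin
  (l′ + 2) * m                  ≡⟨ solve (l′ ∷ m ∷ []) ⟩
  l′ * m + 2 * m                ≤⟨ +-monoˡ-≤ (2 * m) l′m≤n∸1 ⟩
  m + s * suc m + t + 2 * m     ≤⟨ +-monoˡ-≤ (2 * m) (+-monoʳ-≤ (m + s * suc m) t≤m) ⟩
  m + s * suc m + m + 2 * m     ≡⟨ solve (s ∷ m ∷ []) ⟩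
  (suc s + 3) * m + s           ∎
  where open ≤-Reasoning

T⊎if≡else : ∀ {A : Set} b (x y : A) → T b ⊎ (if b then x else y) ≡ y
T⊎if≡else true  _ _ = inj₁ _
T⊎if≡else false _ _ = inj₂ refl

ell-cases : ∀ n k → (n ≡ 19 × k ≡ 4) ⊎ ell n k ≡ ⌈ l′ n k + 1 /2⌉
ell-cases n k with T⊎if≡else ((n ≡ᵇ 19) ∧ (k ≡ᵇ 4)) ⌊ l′ n k + 1 /2⌋ ⌈ l′ n k + 1 /2⌉
... | inj₂ ell≡ = inj₂ ell≡
... | inj₁ is-19-4 with Equivalence.to T-∧ is-19-4
...   | is-19 , is-4 = inj₁ (≡ᵇ⇒≡ n 19 is-19 , ≡ᵇ⇒≡ k 4 is-4)

-- Here 2lm = 18 < n, so the general argument does not apply; the bounds are checked by evaluation.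
integerBounds-19-4 : ∀ {n k} → n ≡ 19 → k ≡ 4 → IntegerBounds n (k ∸ 1) (ell n k) (l′ n k)
integerBounds-19-4 refl refl = record
  { 0<l            = ≤ᵇ⇒≤ _ _ _
  ; 2l≤l′+2        = ≤ᵇ⇒≤ _ _ _
  ; n<2[lm+1]      = ≤ᵇ⇒≤ _ _ _
  ; 2[lm+1]≤n∸1+2k = ≤ᵇ⇒≤ _ _ _
  ; lm≤n           = ≤ᵇ⇒≤ _ _ _
  ; [n∸lm]l<[lm]Cm = ≤ᵇ⇒≤ _ _ _
  }

RationalBounds : (s n k l l′ : ℕ) → Set
RationalBounds s n k l l′ =
  ((⟦ l ⟧ ℚ.≤ ⟦ l′ + 2 ⟧ ÷ℕ 2)
    × (⟦ l′ + 2 ⟧ ÷ℕ 2 ℚ.≤ (⟦ s + 3 ⟧ ℚ.+ (⟦ s ∸ 1 ⟧ ÷ℕ (k ∸ 1))) ÷ℕ 2))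
  × ((⟦ n ⟧ ÷ℕ 2 ℚ.< ⟦ l * (k ∸ 1) + 1 ⟧)
    × (⟦ l * (k ∸ 1) + 1 ⟧ ℚ.≤ (⟦ n ∸ 1 ⟧ ÷ℕ 2) ℚ.+ ⟦ k ⟧))
  × ((⟦ n ⟧ ℚ.- ⟦ l * (k ∸ 1) ⟧) ℚ.< (⟦ 1 ⟧ ÷ℕ l) ℚ.* ⟦ (l * (k ∸ 1)) C (k ∸ 1) ⟧)

integerBounds⇒rationalBounds : ∀ s n m l l′ → IntegerBounds n (suc m) l l′ →
                               (l′ + 2) * suc m ≤ (s + 3) * suc m + (s ∸ 1) →
                               RationalBounds s n (suc (suc m)) l l′
integerBounds⇒rationalBounds s n m zero    l′ b _  = contradiction (IntegerBounds.0<l b) λ ()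
integerBounds⇒rationalBounds s n m (suc l) l′ b a₂ =
    ( ⟦⟧≤⟦⟧÷2 (suc l) (l′ + 2) 2l≤l′+2
    , ⟦⟧÷2≤[⟦⟧+⟦⟧÷d]÷2 (l′ + 2) (s + 3) (s ∸ 1) m a₂ )
  , ( ⟦⟧÷2<⟦⟧ n (suc l * suc m + 1) n<2[lm+1]
    , ⟦⟧≤⟦⟧÷2+⟦⟧ (suc l * suc m + 1) (n ∸ 1) (suc (suc m)) 2[lm+1]≤n∸1+2k )
  , ⟦⟧-⟦⟧<⟦⟧÷l*⟦⟧ n (suc l * suc m) ((suc l * suc m) C suc m) l lm≤n [n∸lm]l<[lm]Cm
  where open IntegerBounds b

lemma10 : (s k t : ℕ) → 4 ≤ s → 4 ≤ k → t ≤ k ∸ 1 →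
  let n = s * k + t
      l = ell n k
      lp = l′ n k
  in ((⟦ l ⟧ ℚ.≤ ⟦ lp + 2 ⟧ ÷ℕ 2)
       × (⟦ lp + 2 ⟧ ÷ℕ 2 ℚ.≤ (⟦ s + 3 ⟧ ℚ.+ (⟦ s ∸ 1 ⟧ ÷ℕ (k ∸ 1))) ÷ℕ 2))
     × ((⟦ n ⟧ ÷ℕ 2 ℚ.< ⟦ l * (k ∸ 1) + 1 ⟧)
       × (⟦ l * (k ∸ 1) + 1 ⟧ ℚ.≤ (⟦ n ∸ 1 ⟧ ÷ℕ 2) ℚ.+ ⟦ k ⟧))
     × (n′ n k ℚ.< (⟦ 1 ⟧ ÷ℕ l) ℚ.* ⟦ (l * (k ∸ 1)) C (k ∸ 1) ⟧)
lemma10 zero     _          _ () _        _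
lemma10 (suc _)  zero       _ _  ()       _
lemma10 (suc _)  (suc zero) _ _  (s≤s ()) _
lemma10 s@(suc s₁) k@(suc m@(suc m₁)) t 4≤s (s≤s 3≤m) t≤m =
  integerBounds⇒rationalBounds s n m₁ (ell n k) lp bounds
    ([l′+2]m≤[1+s+3]m+s {s₁} {m} {t} {lp} t≤m lpm≤n∸1)
  where
  n = s * k + t
  lp = l′ n k
  lpm≤n∸1 : lp * m ≤ n ∸ 1
  lpm≤n∸1 = m/n*n≤m (n ∸ 1) m
  4k≤n : 4 * k ≤ n
  4k≤n = ≤-trans (*-monoˡ-≤ k 4≤s) (m≤m+n (s * k) t)
  bounds : IntegerBounds n m (ell n k) lp
  bounds with ell-cases n k
  ... | inj₁ (n≡19 , k≡4) = integerBounds-19-4 n≡19 k≡4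
  ... | inj₂ ell≡ = subst (λ l → IntegerBounds n m l lp) (sym ell≡)
    (integerBounds 3≤m 4k≤n lpm≤n∸1 (m<[1+m/n]*n (n ∸ 1) m₁)
      (n≤2*⌈n/2⌉ (lp + 1)) (2*⌈n/2⌉≤n+1 (lp + 1)))
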